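{- Let $d, L_1,\dots,L_d$ be positive integers and suppose $A\subseteq [L_1]\times\cdots\times[L_d]\subseteq\mathbb{Z}^d$. Then \[ |A+A| \geq 2^d|A| + \prod_{i=1}^d(2L_i-1) - \prod_{i=1}^d 2L_i. \]
   Context: For a positive integer $n$, $[n]:=\{0,1,\dots,n-1\}$. $A+A:=\{a_1+a_2:a_1,a_2\in A\}$. -}

module Defs where

open import Data.Nat using (ℕ; suc; _+_; _*_; _<_)
open import Data.Vec using (Vec; zipWith; foldr; map)
open import Data.Vec.Relation.Unary.All as VAll using ()
open import Data.Vec.Relation.Binary.Pointwise.Inductive using (Pointwise)
open import Data.List using (List; length)
open import Data.List.Relation.Unary.All using (All)
open import Data.List.Relation.Unary.Unique.Propositional using (Unique)
open import Data.List.Membership.Propositional using (_∈_)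
open import Data.Product using (∃-syntax; _×_)
open import Relation.Binary.PropositionalEquality using (_≡_)
open import Function.Bundles using (_⇔_)

-- A point of ℤ^d with nonnegative coordinates (all points of the box
-- [L_1]×⋯×[L_d] have coordinates in ℕ).
Point : ℕ → Set
Point d = Vec ℕ d

_⊕_ : ∀ {d} → Point d → Point d → Point d
_⊕_ = zipWith _+_

-- x ∈ [L_1]×⋯×[L_d], i.e. 0 ≤ x_i < L_i for every i
InBox : ∀ {d} → Vec ℕ d → Point d → Set
InBox L x = Pointwise _<_ x L

record FinSet (d : ℕ) : Set where
  constructor finSet
  field
    elems  : List (Point d)
    unique : Unique elems
open FinSet public

∣_∣ : ∀ {d} → FinSet d → ℕ
∣ S ∣ = length (elems S)

IsSumset : ∀ {d} → FinSet d → FinSet d → Set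
IsSumset {d} A S =
  (x : Point d) → (x ∈ elems S) ⇔ (∃[ a₁ ] ∃[ a₂ ] (a₁ ∈ elems A × a₂ ∈ elems A × x ≡ a₁ ⊕ a₂))

prod : ∀ {n} → Vec ℕ n → ℕ
prod = foldr _ _*_ 1

-- Induction on d, slicing the box along its first coordinate. For P ⊆ [l] × B let f(x) be the
-- size of the fibre of P over x ∈ B and V_a = {x : f(x) > a} its level sets, so that
-- |P| = Σ_{a<l} |V_a|; likewise let R_b (b < 2l − 1) be the level sets of the fibre sizes of a
-- set Q ⊇ P + P. The one-dimensional Cauchy–Davenport inequality |X + Z| ≥ |X| + |Z| − 1, applied
-- to fibres, gives V_a + V_a ⊆ R_{2a} and V_{a+1} + V_{a+1} ⊆ R_{2a+1}. Summing the bound in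
-- dimension d − 1 over these 2l − 1 pairs gives the bound in dimension d: only V_0 occurs in a
-- single pair, and the missing 2^{d−1} |V_0| is at most ∏_{i≥2} 2L_i.
module Submission where

open import Defs
open import Data.Nat using (ℕ; _<_; _^_; _*_; _∸_)
open import Data.Vec using (Vec; map)
open import Data.Vec.Relation.Unary.All using () renaming (All to VAll)
open import Data.List.Relation.Unary.All using (All)

module Counting where

  open import Data.Bool.Base using (Bool; true; false; T; _∧_; _∨_)
  open import Data.Bool.Properties using (T-≡)
  open import Data.Empty using (⊥; ⊥-elim)
  open import Data.List.Base using ([]; _∷_; length)
  open import Data.List.Relation.Unary.All using ([]; _∷_)
  open import Data.List.Relation.Unary.All.Properties using (All¬⇒¬Any)
  open import Data.List.Relation.Unary.AllPairs using ([]; _∷_)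
  open import Data.List.Relation.Unary.Unique.Propositional using (Unique)
  open import Data.Nat.Base
  open import Data.Nat.Properties
  open import Data.Nat.Tactic.RingSolver using (solve-∀)
  open import Data.Product.Base using (_,_)
  open import Data.Vec.Base using ([]; _∷_)
  open import Data.Vec.Properties using (≡-dec)
  open import Data.Vec.Relation.Binary.Pointwise.Inductive as Pointwise using ([]; _∷_)
  open import Function.Bundles using (Equivalence)
  open import Relation.Binary.Definitions using (DecidableEquality)
  open import Relation.Binary.PropositionalEquality
  open import Relation.Nullary.Decidable using (Dec; yes; no; does; _because_; dec-true)
  open import Relation.Nullary.Reflects using (invert)

  iverson : Bool → ℕ
  iverson true  = 1
  iverson false = 0

  iverson-mono : ∀ {b c} → (T b → T c) → iverson b ≤ iverson c
  iverson-mono {false}         _   = z≤n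
  iverson-mono {true}  {true}  _   = ≤-refl
  iverson-mono {true}  {false} b⇒c = ⊥-elim (b⇒c _)

  iverson-≤1 : ∀ b → iverson b ≤ 1
  iverson-≤1 b = iverson-mono {c = true} _

  iverson-∧ : ∀ b c → iverson (b ∧ c) ≡ iverson b * iverson c
  iverson-∧ false c = refl
  iverson-∧ true  c = sym (+-identityʳ (iverson c))

  iverson-∨ : ∀ b c → iverson (b ∨ c) ≤ iverson b + iverson c
  iverson-∨ false c = ≤-refl
  iverson-∨ true  c = m≤m+n 1 (iverson c)

  iverson-∨-disjoint : ∀ b c → (T b → T c → ⊥) → iverson b + iverson c ≡ iverson (b ∨ c)
  iverson-∨-disjoint false c     _        = refl
  iverson-∨-disjoint true  false _        = refl
  iverson-∨-disjoint true  true  disjoint = ⊥-elim (disjoint _ _)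

  does-sound : ∀ {A : Set} (a? : Dec A) → T (does a?) → A
  does-sound (true because [a]) _ = invert [a]

  does-complete : ∀ {A : Set} (a? : Dec A) → A → T (does a?)
  does-complete a? a = Equivalence.from T-≡ (dec-true a? a)

  ∑ : ℕ → (ℕ → ℕ) → ℕ
  ∑ zero    f = 0
  ∑ (suc n) f = f n + ∑ n f

  syntax ∑ n (λ i → e) = ∑[ i < n ] e

  ∑-cong : ∀ n {f g : ℕ → ℕ} → (∀ i → f i ≡ g i) → ∑ n f ≡ ∑ n g
  ∑-cong zero    f≡g = refl
  ∑-cong (suc n) f≡g = cong₂ _+_ (f≡g n) (∑-cong n f≡g)

  ∑-mono : ∀ n {f g : ℕ → ℕ} → (∀ {i} → i < n → f i ≤ g i) → ∑ n f ≤ ∑ n g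
  ∑-mono zero    f≤g = z≤n
  ∑-mono (suc n) f≤g = +-mono-≤ (f≤g (n<1+n n)) (∑-mono n (λ i<n → f≤g (m<n⇒m<1+n i<n)))

  ∑-const : ∀ n c → ∑[ _ < n ] c ≡ n * c
  ∑-const zero    c = refl
  ∑-const (suc n) c = cong (c +_) (∑-const n c)

  ∑-distrib-+ : ∀ n (f g : ℕ → ℕ) → ∑[ i < n ] (f i + g i) ≡ ∑ n f + ∑ n g
  ∑-distrib-+ zero    f g = refl
  ∑-distrib-+ (suc n) f g = trans (cong (f n + g n +_) (∑-distrib-+ n f g)) (interchange (f n) (g n) _ _)
    where
    interchange : ∀ a b c d → a + b + (c + d) ≡ a + c + (b + d)
    interchange = solve-∀

  ∑-distribˡ-* : ∀ n k (f : ℕ → ℕ) → ∑[ i < n ] (k * f i) ≡ k * ∑ n f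
  ∑-distribˡ-* zero    k f = sym (*-zeroʳ k)
  ∑-distribˡ-* (suc n) k f = trans (cong (k * f n +_) (∑-distribˡ-* n k f)) (sym (*-distribˡ-+ k (f n) _))

  ∑-distribʳ-* : ∀ n k (f : ℕ → ℕ) → ∑[ i < n ] (f i * k) ≡ ∑ n f * k
  ∑-distribʳ-* zero    k f = refl
  ∑-distribʳ-* (suc n) k f = trans (cong (f n * k +_) (∑-distribʳ-* n k f)) (sym (*-distribʳ-+ k (f n) _))

  ∑-front : ∀ n (f : ℕ → ℕ) → ∑ (suc n) f ≡ f 0 + ∑[ i < n ] f (suc i)
  ∑-front zero    f = refl
  ∑-front (suc n) f = trans (cong (f (suc n) +_) (∑-front n f)) (+-comm-left (f (suc n)) (f 0) _)
    where
    +-comm-left : ∀ a b c → a + (b + c) ≡ b + (a + c)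
    +-comm-left = solve-∀

  ∑-comm : ∀ m n (f : ℕ → ℕ → ℕ) → ∑[ i < m ] ∑[ j < n ] f i j ≡ ∑[ j < n ] ∑[ i < m ] f i j
  ∑-comm zero    n f = sym (trans (∑-const n 0) (*-zeroʳ n))
  ∑-comm (suc m) n f = trans (cong (∑ n (f m) +_) (∑-comm m n f)) (sym (∑-distrib-+ n (f m) _))

  ∑-shift : ∀ p n (f : ℕ → ℕ) → ∑ (p + n) f ≡ ∑[ j < n ] f (p + j) + ∑ p f
  ∑-shift p zero    f = cong (λ m → ∑ m f) (+-identityʳ p)
  ∑-shift p (suc n) f = begin
    ∑ (p + suc n) f                           ≡⟨ cong (λ m → ∑ m f) (+-suc p n) ⟩
    f (p + n) + ∑ (p + n) f                   ≡⟨ cong (f (p + n) +_) (∑-shift p n f) ⟩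
    f (p + n) + (∑[ j < n ] f (p + j) + ∑ p f) ≡⟨ sym (+-assoc (f (p + n)) _ _) ⟩
    ∑[ j < suc n ] f (p + j) + ∑ p f          ∎
    where open ≡-Reasoning

  ∑-interleave : ∀ n (f : ℕ → ℕ) →
    ∑ (suc (n + n)) f ≡ ∑[ a < suc n ] f (a + a) + ∑[ a < n ] f (suc (a + a))
  ∑-interleave n f = trans (cong (f (n + n) +_) (even n)) (sym (+-assoc (f (n + n)) _ _))
    where
    even : ∀ n → ∑ (n + n) f ≡ ∑[ a < n ] f (a + a) + ∑[ a < n ] f (suc (a + a))
    even zero    = refl
    even (suc n) = begin
      ∑ (suc n + suc n) f                               ≡⟨ cong (λ m → ∑ (suc m) f) (+-suc n n) ⟩
      f (suc (n + n)) + (f (n + n) + ∑ (n + n) f)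
        ≡⟨ cong (λ s → f (suc (n + n)) + (f (n + n) + s)) (even n) ⟩
      f (suc (n + n)) + (f (n + n) + (evens + odds))     ≡⟨ regroup (f (suc (n + n))) (f (n + n)) evens odds ⟩
      f (n + n) + evens + (f (suc (n + n)) + odds)       ∎
      where
      open ≡-Reasoning
      evens = ∑[ a < n ] f (a + a)
      odds  = ∑[ a < n ] f (suc (a + a))
      regroup : ∀ y x e o → y + (x + (e + o)) ≡ x + e + (y + o)
      regroup = solve-∀

  ∑-mono-affine : ∀ n k c e {f g : ℕ → ℕ} → (∀ i → k * f i + c ≤ g i + e) →
    k * ∑ n f + n * c ≤ ∑ n g + n * e
  ∑-mono-affine zero    k c e le = ≤-reflexive (cong (_+ 0) (*-zeroʳ k))
  ∑-mono-affine (suc n) k c e {f} {g} le = begin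
    k * (f n + ∑ n f) + suc n * c       ≡⟨ split k (f n) (∑ n f) n c ⟩
    (k * f n + c) + (k * ∑ n f + n * c) ≤⟨ +-mono-≤ (le n) (∑-mono-affine n k c e le) ⟩
    (g n + e) + (∑ n g + n * e)         ≡⟨ merge (g n) (∑ n g) n e ⟩
    (g n + ∑ n g) + suc n * e           ∎
    where
    open ≤-Reasoning
    split : ∀ k x s n c → k * (x + s) + (1 + n) * c ≡ (k * x + c) + (k * s + n * c)
    split = solve-∀
    merge : ∀ y s n e → (y + e) + (s + n * e) ≡ (y + s) + (1 + n) * e
    merge = solve-∀

  count : ℕ → (ℕ → Bool) → ℕ
  count n X = ∑[ i < n ] iverson (X i)

  count-≤ : ∀ n X → count n X ≤ n
  count-≤ zero    X = z≤n
  count-≤ (suc n) X = +-mono-≤ (iverson-≤1 (X n)) (count-≤ n X)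

  count-≤-suc : ∀ n X → count n X ≤ count (suc n) X
  count-≤-suc n X = m≤n+m (count n X) (iverson (X n))

  count-mono : ∀ n {X Y : ℕ → Bool} → (∀ {i} → i < n → T (X i) → T (Y i)) → count n X ≤ count n Y
  count-mono n X⇒Y = ∑-mono n (λ i<n → iverson-mono (X⇒Y i<n))

  count-<ᵇ : ∀ n m → count n (_<ᵇ m) ≡ n ⊓ m
  count-<ᵇ zero    m       = refl
  count-<ᵇ (suc n) zero    = trans (count-<ᵇ n 0) (⊓-zeroʳ n)
  count-<ᵇ (suc n) (suc m) = trans (∑-front n _) (cong suc (count-<ᵇ n m))

  count-≡ᵇ : ∀ n x → count n (_≡ᵇ x) ≡ iverson (x <ᵇ n)
  count-≡ᵇ zero    x       = refl
  count-≡ᵇ (suc n) zero    = trans (∑-front n _) (cong suc (trans (∑-const n 0) (*-zeroʳ n)))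
  count-≡ᵇ (suc n) (suc x) = trans (∑-front n _) (count-≡ᵇ n x)

  -- q is the largest element of Z. If X has an element below p, induction on p applies and p + q is
  -- a new element of Y; otherwise X = {p} and p + Z ⊆ Y.
  cauchyDavenport-top : ∀ p q {X Z Y : ℕ → Bool} → T (Z q) → 0 < count (suc p) X →
    (∀ {i j} → i ≤ p → j ≤ q → T (X i) → T (Z j) → T (Y (i + j))) →
    count (suc p) X + count (suc q) Z ≤ suc (count (suc (p + q)) Y)
  cauchyDavenport-top p q {X} zq nonempty closed with X p in xp
  cauchyDavenport-top zero    q zq () closed | false
  cauchyDavenport-top (suc p) q {X} {Z} {Y} zq nonempty closed | false =
    ≤-trans (cauchyDavenport-top p q {Y = Y} zq nonempty (λ i≤p → closed (m≤n⇒m≤1+n i≤p)))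
      (s≤s (count-≤-suc _ Y))
  cauchyDavenport-top p q {X} zq nonempty closed | true with count p X ≟ 0
  cauchyDavenport-top p q {X} {Z} {Y} zq nonempty closed | true | yes none-below =
    ≤-trans (≤-reflexive (cong (λ c → suc c + count (suc q) Z) none-below)) (s≤s (begin
      count (suc q) Z                             ≤⟨ count-mono (suc q) (λ j<1+q → closed ≤-refl (≤-pred j<1+q) px) ⟩
      count (suc q) (λ j → Y (p + j))             ≤⟨ m≤m+n _ _ ⟩
      count (suc q) (λ j → Y (p + j)) + count p Y ≡⟨ sym (∑-shift p (suc q) _) ⟩
      count (p + suc q) Y                         ≡⟨ cong (λ m → count m Y) (+-suc p q) ⟩
      count (suc (p + q)) Y                       ∎))
    where
    open ≤-Reasoning
    px = Equivalence.from T-≡ xp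
  cauchyDavenport-top zero    q zq nonempty closed | true | no some-below = ⊥-elim (some-below refl)
  cauchyDavenport-top (suc p) q {X} {Z} {Y} zq nonempty closed | true | no some-below =
    s≤s (≤-trans below (+-monoˡ-≤ _ (iverson-mono {true} (λ _ → top))))
    where
    below = cauchyDavenport-top p q {Y = Y} zq (n≢0⇒n>0 some-below) (λ i≤p → closed (m≤n⇒m≤1+n i≤p))
    top = closed ≤-refl ≤-refl (Equivalence.from T-≡ xp) zq

  cauchyDavenport : ∀ p q {X Z Y : ℕ → Bool} → 0 < count (suc p) X → 0 < count (suc q) Z →
    (∀ {i j} → i ≤ p → j ≤ q → T (X i) → T (Z j) → T (Y (i + j))) →
    count (suc p) X + count (suc q) Z ≤ suc (count (suc (p + q)) Y)
  cauchyDavenport p q {Z = Z} nx nz closed with Z q in zq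
  cauchyDavenport p zero    nx () closed | false
  cauchyDavenport p (suc q) {Y = Y} nx nz closed | false = ≤-trans
    (cauchyDavenport p q {Y = Y} nx nz (λ i≤p j≤q → closed i≤p (m≤n⇒m≤1+n j≤q)))
    (s≤s (≤-trans (count-≤-suc _ Y) (≤-reflexive (cong (λ m → count (suc m) Y) (sym (+-suc p q))))))
  cauchyDavenport p q {X} {Z} {Y} nx nz closed | true =
    subst (λ b → count (suc p) X + (iverson b + count q Z) ≤ suc (count (suc (p + q)) Y)) zq
      (cauchyDavenport-top p q (Equivalence.from T-≡ zq) nx closed)

  ∑box : ∀ {d} → Vec ℕ d → (Point d → ℕ) → ℕ
  ∑box []      w = w []
  ∑box (l ∷ L) w = ∑[ t < l ] ∑box L (λ x → w (t ∷ x))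

  countBox : ∀ {d} → Vec ℕ d → (Point d → Bool) → ℕ
  countBox L P = ∑box L (λ x → iverson (P x))

  ∑box-cong : ∀ {d} (L : Vec ℕ d) {v w : Point d → ℕ} → (∀ x → v x ≡ w x) → ∑box L v ≡ ∑box L w
  ∑box-cong []      v≡w = v≡w []
  ∑box-cong (l ∷ L) v≡w = ∑-cong l (λ t → ∑box-cong L (λ x → v≡w (t ∷ x)))

  ∑box-mono : ∀ {d} (L : Vec ℕ d) {v w : Point d → ℕ} → (∀ x → v x ≤ w x) → ∑box L v ≤ ∑box L w
  ∑box-mono []      v≤w = v≤w []
  ∑box-mono (l ∷ L) v≤w = ∑-mono l (λ {t} _ → ∑box-mono L (λ x → v≤w (t ∷ x)))

  ∑box-distrib-+ : ∀ {d} (L : Vec ℕ d) (v w : Point d → ℕ) →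
    ∑box L (λ x → v x + w x) ≡ ∑box L v + ∑box L w
  ∑box-distrib-+ []      v w = refl
  ∑box-distrib-+ (l ∷ L) v w =
    trans (∑-cong l (λ t → ∑box-distrib-+ L (λ x → v (t ∷ x)) (λ x → w (t ∷ x)))) (∑-distrib-+ l _ _)

  ∑box-distribˡ-* : ∀ {d} (L : Vec ℕ d) k (w : Point d → ℕ) → ∑box L (λ x → k * w x) ≡ k * ∑box L w
  ∑box-distribˡ-* []      k w = refl
  ∑box-distribˡ-* (l ∷ L) k w =
    trans (∑-cong l (λ t → ∑box-distribˡ-* L k (λ x → w (t ∷ x)))) (∑-distribˡ-* l k _)

  ∑box-const : ∀ {d} (L : Vec ℕ d) c → ∑box L (λ _ → c) ≡ prod L * c
  ∑box-const []      c = sym (*-identityˡ c)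
  ∑box-const (l ∷ L) c = begin
    ∑[ _ < l ] ∑box L (λ _ → c) ≡⟨ ∑-cong l (λ _ → ∑box-const L c) ⟩
    ∑[ _ < l ] (prod L * c)     ≡⟨ ∑-const l _ ⟩
    l * (prod L * c)            ≡⟨ sym (*-assoc l (prod L) c) ⟩
    l * prod L * c              ∎
    where open ≡-Reasoning

  ∑box-∑-comm : ∀ {d} (L : Vec ℕ d) n (w : ℕ → Point d → ℕ) →
    ∑box L (λ x → ∑[ i < n ] w i x) ≡ ∑[ i < n ] ∑box L (w i)
  ∑box-∑-comm []      n w = refl
  ∑box-∑-comm (l ∷ L) n w =
    trans (∑-cong l (λ t → ∑box-∑-comm L n (λ i x → w i (t ∷ x)))) (∑-comm l n _)

  countBox-≤-prod : ∀ {d} (L : Vec ℕ d) P → countBox L P ≤ prod L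
  countBox-≤-prod L P = begin
    countBox L P        ≤⟨ ∑box-mono L (λ x → iverson-≤1 (P x)) ⟩
    ∑box L (λ _ → 1)    ≡⟨ ∑box-const L 1 ⟩
    prod L * 1          ≡⟨ *-identityʳ (prod L) ⟩
    prod L              ∎
    where open ≤-Reasoning

  layerCake : ∀ {d} (L : Vec ℕ d) n (w : Point d → ℕ) → (∀ x → w x ≤ n) →
    ∑[ a < n ] countBox L (λ x → a <ᵇ w x) ≡ ∑box L w
  layerCake L n w w≤n = begin
    ∑[ a < n ] countBox L (λ x → a <ᵇ w x) ≡⟨ sym (∑box-∑-comm L n (λ a x → iverson (a <ᵇ w x))) ⟩
    ∑box L (λ x → count n (_<ᵇ w x))      ≡⟨ ∑box-cong L (λ x → count-<ᵇ n (w x)) ⟩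
    ∑box L (λ x → n ⊓ w x)                ≡⟨ ∑box-cong L (λ x → m≥n⇒m⊓n≡n (w≤n x)) ⟩
    ∑box L w                              ∎
    where open ≡-Reasoning

  fiberCount : ∀ {d} → ℕ → (Point (suc d) → Bool) → Point d → ℕ
  fiberCount l P x = count l (λ t → P (t ∷ x))

  countBox-layers : ∀ {d} l (L : Vec ℕ d) P →
    countBox (l ∷ L) P ≡ ∑[ a < l ] countBox L (λ x → a <ᵇ fiberCount l P x)
  countBox-layers l L P = begin
    countBox (l ∷ L) P                                   ≡⟨ sym (∑box-∑-comm L l _) ⟩
    ∑box L (fiberCount l P)                              ≡⟨ sym (layerCake L l _ (λ x → count-≤ l _)) ⟩
    ∑[ a < l ] countBox L (λ x → a <ᵇ fiberCount l P x)  ∎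
    where open ≡-Reasoning

  SumsetWithin : ∀ {d} → Vec ℕ d → (Point d → Bool) → (Point d → Bool) → Set
  SumsetWithin L P Q = ∀ {a b} → InBox L a → InBox L b → T (P a) → T (P b) → T (Q (a ⊕ b))

  levelSet-sumset : ∀ {d} n (L : Vec ℕ d) {P Q : Point (suc d) → Bool} → SumsetWithin (suc n ∷ L) P Q →
    ∀ {b e} → e ≤ b + b →
    SumsetWithin L (λ x → b <ᵇ fiberCount (suc n) P x) (λ y → e <ᵇ fiberCount (suc (n + n)) Q y)
  levelSet-sumset n L {P} {Q} sumset {b} {e} e≤b+b {x} {z} x∈L z∈L b<ᵇfx b<ᵇfz = <⇒<ᵇ (begin-strict
    e                                   ≤⟨ e≤b+b ⟩
    b + b                               <⟨ +-monoʳ-< b (n<1+n b) ⟩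
    b + suc b                           ≤⟨ ≤-pred (≤-trans (+-mono-≤ b<fx b<fz) fibers) ⟩
    fiberCount (suc (n + n)) Q (x ⊕ z)  ∎)
    where
    open ≤-Reasoning
    b<fx = <ᵇ⇒< b _ b<ᵇfx
    b<fz = <ᵇ⇒< b _ b<ᵇfz
    fibers : fiberCount (suc n) P x + fiberCount (suc n) P z ≤ suc (fiberCount (suc (n + n)) Q (x ⊕ z))
    fibers = cauchyDavenport n n {Y = λ s → Q (s ∷ (x ⊕ z))}
      (≤-trans (s≤s z≤n) b<fx) (≤-trans (s≤s z≤n) b<fz) (λ i≤n j≤n → sumset (s≤s i≤n ∷ x∈L) (s≤s j≤n ∷ z∈L))

  prod-map-2* : ∀ {d} (L : Vec ℕ d) → prod (map (2 *_) L) ≡ 2 ^ d * prod L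
  prod-map-2* []              = refl
  prod-map-2* {suc d} (l ∷ L) = trans (cong (2 * l *_) (prod-map-2* L)) (reorder l (2 ^ d) (prod L))
    where
    reorder : ∀ l k p → 2 * l * (k * p) ≡ 2 * k * (l * p)
    reorder = solve-∀

  2*suc∸1 : ∀ n → 2 * suc n ∸ 1 ≡ suc (n + n)
  2*suc∸1 n = trans (cong (n +_) (+-identityʳ (suc n))) (+-suc n n)

  combine-layer-bounds : ∀ {k n V₀ W X₁ X₂ c e V} → V ≡ V₀ + W →
    k * V + suc n * c ≤ X₁ + suc n * e → k * W + n * c ≤ X₂ + n * e → k * V₀ ≤ e →
    2 * k * V + suc (n + n) * c ≤ X₁ + X₂ + 2 * suc n * e
  combine-layer-bounds {k} {n} {V₀} {W} {X₁} {X₂} {c} {e} refl all upper bottom = begin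
    2 * k * (V₀ + W) + suc (n + n) * c                      ≡⟨ split k n V₀ W c ⟩
    (k * (V₀ + W) + suc n * c) + (k * W + n * c) + k * V₀  ≤⟨ +-mono-≤ (+-mono-≤ all upper) bottom ⟩
    (X₁ + suc n * e) + (X₂ + n * e) + e                    ≡⟨ merge X₁ X₂ n e ⟩
    X₁ + X₂ + 2 * suc n * e                                ∎
    where
    open ≤-Reasoning
    split : ∀ k n V₀ W c →
      2 * k * (V₀ + W) + suc (n + n) * c ≡ (k * (V₀ + W) + suc n * c) + (k * W + n * c) + k * V₀
    split = solve-∀
    merge : ∀ X₁ X₂ n e → (X₁ + suc n * e) + (X₂ + n * e) + e ≡ X₁ + X₂ + 2 * suc n * e
    merge = solve-∀

  sumset-countBox : ∀ {d} (L : Vec ℕ d) {P Q : Point d → Bool} → SumsetWithin L P Q →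
    2 ^ d * countBox L P + prod (map (λ l → 2 * l ∸ 1) L) ≤
    countBox (map (λ l → 2 * l ∸ 1) L) Q + prod (map (2 *_) L)
  sumset-countBox [] sumset =
    +-monoˡ-≤ 1 (≤-trans (≤-reflexive (*-identityˡ _)) (iverson-mono (λ p → sumset [] [] p p)))
  sumset-countBox {suc d} (zero ∷ L) sumset =
    ≤-trans (≤-reflexive (trans (+-identityʳ _) (*-zeroʳ (2 ^ suc d)))) z≤n
  sumset-countBox {suc d} (suc n ∷ L) {P} {Q} sumset =
    subst (λ m → 2 ^ suc d * countBox (suc n ∷ L) P + m * P₂ ≤ countBox (m ∷ L′) Q + 2 * suc n * P₁)
      (sym (2*suc∸1 n)) bound
    where
    open ≤-Reasoning
    L′ = map (λ l → 2 * l ∸ 1) L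
    P₁ = prod (map (2 *_) L)
    P₂ = prod L′
    m  = suc (n + n)
    V : ℕ → Point d → Bool
    V a x = a <ᵇ fiberCount (suc n) P x
    R : ℕ → Point d → Bool
    R b y = b <ᵇ fiberCount m Q y
    v r : ℕ → ℕ
    v a = countBox L (V a)
    r b = countBox L′ (R b)
    upper evens odds : ℕ
    upper = ∑[ a < n ] v (suc a)
    evens = ∑[ a < suc n ] r (a + a)
    odds  = ∑[ a < n ] r (suc (a + a))
    even-layers : ∀ a → 2 ^ d * v a + P₂ ≤ r (a + a) + P₁
    even-layers a = sumset-countBox L (levelSet-sumset n L {Q = Q} sumset ≤-refl)
    odd-layers : ∀ a → 2 ^ d * v (suc a) + P₂ ≤ r (suc (a + a)) + P₁
    odd-layers a = sumset-countBox L (levelSet-sumset n L {Q = Q} sumset (s≤s (+-monoʳ-≤ a (n≤1+n a))))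
    bottom-layer : 2 ^ d * v 0 ≤ P₁
    bottom-layer = ≤-trans (*-monoʳ-≤ (2 ^ d) (countBox-≤-prod L (V 0))) (≤-reflexive (sym (prod-map-2* L)))
    bound : 2 * 2 ^ d * countBox (suc n ∷ L) P + m * P₂ ≤ countBox (m ∷ L′) Q + 2 * suc n * P₁
    bound = begin
      2 * 2 ^ d * countBox (suc n ∷ L) P + m * P₂
        ≡⟨ cong (λ s → 2 * 2 ^ d * s + m * P₂) (countBox-layers (suc n) L P) ⟩
      2 * 2 ^ d * ∑ (suc n) v + m * P₂
        ≤⟨ combine-layer-bounds {2 ^ d} {n} {v 0} {upper} {evens} {odds} (∑-front n v)
             (∑-mono-affine (suc n) (2 ^ d) P₂ P₁ even-layers) (∑-mono-affine n (2 ^ d) P₂ P₁ odd-layers)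
             bottom-layer ⟩
      evens + odds + 2 * suc n * P₁
        ≡⟨ cong (_+ 2 * suc n * P₁) (sym (trans (countBox-layers m L′ Q) (∑-interleave n r))) ⟩
      countBox (m ∷ L′) Q + 2 * suc n * P₁
        ∎

  _≟ᵛ_ : ∀ {d} → DecidableEquality (Point d)
  _≟ᵛ_ = ≡-dec _≟_

  inBox? : ∀ {d} (L : Vec ℕ d) x → Dec (InBox L x)
  inBox? L x = Pointwise.decidable _<?_ x L

  countBox-≡ : ∀ {d} (M x : Point d) → countBox M (λ y → does (y ≟ᵛ x)) ≡ iverson (does (inBox? M x))
  countBox-≡ []      []       = refl
  countBox-≡ (m ∷ M) (x ∷ xs) = begin
    ∑[ t < m ] countBox M (λ y → (t ≡ᵇ x) ∧ does (y ≟ᵛ xs))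
      ≡⟨ ∑-cong m (λ t → trans (∑box-cong M (λ y → iverson-∧ (t ≡ᵇ x) _))
                               (∑box-distribˡ-* M (iverson (t ≡ᵇ x)) _)) ⟩
    ∑[ t < m ] (iverson (t ≡ᵇ x) * countBox M (λ y → does (y ≟ᵛ xs)))
      ≡⟨ ∑-distribʳ-* m _ _ ⟩
    count m (_≡ᵇ x) * countBox M (λ y → does (y ≟ᵛ xs))
      ≡⟨ cong₂ _*_ (count-≡ᵇ m x) (countBox-≡ M xs) ⟩
    iverson (x <ᵇ m) * iverson (does (inBox? M xs))
      ≡⟨ sym (iverson-∧ (x <ᵇ m) _) ⟩
    iverson (does (inBox? (m ∷ M) (x ∷ xs)))
      ∎
    where open ≡-Reasoning

  module _ {d : ℕ} where

    open import Data.List.Membership.DecPropositional (_≟ᵛ_ {d}) using (_∈_; _∈?_)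

    countBox-∈-≤-length : ∀ (M : Vec ℕ d) xs → countBox M (λ y → does (y ∈? xs)) ≤ length xs
    countBox-∈-≤-length M []       = ≤-reflexive (trans (∑box-const M 0) (*-zeroʳ (prod M)))
    countBox-∈-≤-length M (x ∷ xs) = begin
      countBox M (λ y → does (y ∈? (x ∷ xs)))
        ≤⟨ ∑box-mono M (λ y → iverson-∨ (does (y ≟ᵛ x)) (does (y ∈? xs))) ⟩
      ∑box M (λ y → iverson (does (y ≟ᵛ x)) + iverson (does (y ∈? xs)))
        ≡⟨ ∑box-distrib-+ M _ _ ⟩
      countBox M (λ y → does (y ≟ᵛ x)) + countBox M (λ y → does (y ∈? xs))
        ≤⟨ +-mono-≤ (≤-trans (≤-reflexive (countBox-≡ M x)) (iverson-≤1 _)) (countBox-∈-≤-length M xs) ⟩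
      suc (length xs)
        ∎
      where open ≤-Reasoning

    length-≤-countBox-∈ : ∀ (L : Vec ℕ d) {xs} → Unique xs → All (InBox L) xs →
      length xs ≤ countBox L (λ y → does (y ∈? xs))
    length-≤-countBox-∈ L [] [] = z≤n
    length-≤-countBox-∈ L {x ∷ xs} (x∉xs ∷ unique) (x∈L ∷ xs⊆L) = begin
      suc (length xs)
        ≤⟨ +-mono-≤ (≤-trans (iverson-mono (λ _ → does-complete (inBox? L x) x∈L))
                             (≤-reflexive (sym (countBox-≡ L x))))
                    (length-≤-countBox-∈ L unique xs⊆L) ⟩
      countBox L (λ y → does (y ≟ᵛ x)) + countBox L (λ y → does (y ∈? xs))
        ≡⟨ sym (∑box-distrib-+ L _ _) ⟩
      ∑box L (λ y → iverson (does (y ≟ᵛ x)) + iverson (does (y ∈? xs)))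
        ≡⟨ ∑box-cong L (λ y → iverson-∨-disjoint _ _ λ y≡x y∈xs →
             All¬⇒¬Any x∉xs (subst (_∈ xs) (does-sound (y ≟ᵛ x) y≡x) (does-sound (y ∈? xs) y∈xs))) ⟩
      countBox L (λ y → does (y ∈? (x ∷ xs)))
        ∎
      where open ≤-Reasoning

    sumset-bound : ∀ (L : Vec ℕ d) (A S : FinSet d) → All (InBox L) (elems A) → IsSumset A S →
      2 ^ d * ∣ A ∣ + prod (map (λ l → 2 * l ∸ 1) L) ≤ ∣ S ∣ + prod (map (2 *_) L)
    sumset-bound L A S A⊆L sumset = begin
      2 ^ d * ∣ A ∣ + prod L′
        ≤⟨ +-monoˡ-≤ _ (*-monoʳ-≤ (2 ^ d) (length-≤-countBox-∈ L (unique A) A⊆L)) ⟩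
      2 ^ d * countBox L (λ y → does (y ∈? elems A)) + prod L′
        ≤⟨ sumset-countBox L closed ⟩
      countBox L′ (λ y → does (y ∈? elems S)) + prod (map (2 *_) L)
        ≤⟨ +-monoˡ-≤ _ (countBox-∈-≤-length L′ (elems S)) ⟩
      ∣ S ∣ + prod (map (2 *_) L)
        ∎
      where
      open ≤-Reasoning
      L′ = map (λ l → 2 * l ∸ 1) L
      closed : SumsetWithin L (λ y → does (y ∈? elems A)) (λ y → does (y ∈? elems S))
      closed {a} {b} _ _ a∈A b∈A = does-complete (a ⊕ b ∈? elems S) (Equivalence.from (sumset (a ⊕ b))
        (a , b , does-sound (a ∈? elems A) a∈A , does-sound (b ∈? elems A) b∈A , refl))

open Counting using (sumset-bound)

open import Data.Integer using (ℤ; +_; _+_; _-_; _≤_)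
open import Data.Integer.Base using (_⊖_)
import Data.Integer.Properties as ℤ
import Data.Nat as ℕ
import Data.Nat.Properties as ℕ
open import Relation.Binary.PropositionalEquality using (sym; cong; cong₂)

ℕ-bound⇒ℤ-bound : ∀ a b c e → a ℕ.+ b ℕ.≤ c ℕ.+ e → + a + + b - + e ≤ + c
ℕ-bound⇒ℤ-bound a b c e a+b≤c+e = begin
  + a + + b - + e              ≡⟨ cong (_- + e) (sym (ℤ.pos-+ a b)) ⟩
  + (a ℕ.+ b) - + e            ≡⟨ ℤ.m-n≡m⊖n (a ℕ.+ b) e ⟩
  (a ℕ.+ b) ⊖ e                ≤⟨ ℤ.⊖-monoˡ-≤ e a+b≤c+e ⟩
  (c ℕ.+ e) ⊖ e                ≡⟨ cong₂ _⊖_ (ℕ.+-comm c e) (sym (ℕ.+-identityʳ e)) ⟩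
  (e ℕ.+ c) ⊖ (e ℕ.+ 0)        ≡⟨ ℤ.+-cancelˡ-⊖ e c 0 ⟩
  + c                          ∎
  where open ℤ.≤-Reasoning

theorem2p1 : (d : ℕ) → 0 < d → (L : Vec ℕ d) → VAll (0 <_) L →
    (A S : FinSet d) → All (InBox L) (elems A) → IsSumset A S →
    (+ (2 ^ d * ∣ A ∣)) + (+ prod (map (λ l → 2 * l ∸ 1) L)) - (+ prod (map (λ l → 2 * l) L)) ≤ + ∣ S ∣
theorem2p1 d _ L _ A S A⊆L sumset = ℕ-bound⇒ℤ-bound (2 ^ d * ∣ A ∣) _ _ _ (sumset-bound L A S A⊆L sumset)
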